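{- Let $n \geq 1$. For every integer $w$ with $0 \leq w \leq \lceil n/2 \rceil$, the number of vertices of the Fibonacci-run graph $\mathcal{R}_n$ of Hamming weight $w$ is $\binom{n-w+1}{w}$.
   Context: A binary string is called run-constrained if every run (maximal block) of consecutive $1$s in it is immediately followed by a run of $0$s of strictly greater length. For $n \geq 1$, the Fibonacci-run graph $\mathcal{R}_n$ has vertex set $\{ w \in \{0,1\}^n : w00 \text{ is a run-constrained string of length } n+2\}$, and two vertices are adjacent iff they differ in exactly one coordinate. The Hamming weight of a binary string is its number of $1$s. -}

module Defs where

open import Data.Bool using (Bool; true; false; _∧_; if_then_else_)
open import Data.Nat using (ℕ; zero; suc; _<ᵇ_; _+_)
open import Data.List using (List; []; _∷_; length; filter; map; concatMap; _++_; replicate)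
open import Data.Product using (_×_; _,_)
open import Data.Vec using (Vec; toList)
import Data.Vec as Vec
open import Relation.Nullary.Decidable using (Dec; yes; no)
open import Relation.Binary.PropositionalEquality using (_≡_)
open import Data.Bool.Properties using (T?)
open import Data.Bool using (T)

eqB : Bool → Bool → Bool
eqB true true = true
eqB false false = true
eqB _ _ = false

runs : List Bool → List (Bool × ℕ)
runs [] = []
runs (b ∷ s) with runs s
... | [] = (b , 1) ∷ []
... | (c , k) ∷ rs = if eqB b c then (c , suc k) ∷ rs else (b , 1) ∷ (c , k) ∷ rs

rcRuns : List (Bool × ℕ) → Bool
rcRuns [] = true
rcRuns ((false , _) ∷ rs) = rcRuns rs
rcRuns ((true , k) ∷ []) = false
rcRuns ((true , k) ∷ (false , m) ∷ rs) = (k <ᵇ m) ∧ rcRuns ((false , m) ∷ rs)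
rcRuns ((true , k) ∷ (true , m) ∷ rs) = false   -- impossible for maximal runs

RunConstrained : List Bool → Set
RunConstrained s = T (rcRuns (runs s))

runConstrained? : (s : List Bool) → Dec (RunConstrained s)
runConstrained? s = T? (rcRuns (runs s))

IsVertex : {n : ℕ} → Vec Bool n → Set
IsVertex w = RunConstrained (toList w ++ false ∷ false ∷ [])

isVertex? : {n : ℕ} → (w : Vec Bool n) → Dec (IsVertex w)
isVertex? w = runConstrained? (toList w ++ false ∷ false ∷ [])

allVecs : (n : ℕ) → List (Vec Bool n)
allVecs zero = Vec.[] ∷ []
allVecs (suc n) = map (true Vec.∷_) (allVecs n) ++ map (false Vec.∷_) (allVecs n)

weight : {n : ℕ} → Vec Bool n → ℕ
weight Vec.[] = 0
weight (true Vec.∷ w) = suc (weight w)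
weight (false Vec.∷ w) = weight w

vertices : (n : ℕ) → List (Vec Bool n)
vertices n = filter isVertex? (allVecs n)

-- A word w has w00 run-constrained iff a small automaton accepts it, whose state records
-- either the length j of the current run of 1s or how many 0s that run is still owed.
-- Splitting the words of length n and weight w by their first letter gives a transfer
-- recurrence for these counts, and deleting one 1 and one 0 from the first block shows that a
-- leading 1 costs exactly one letter besides itself. Hence the number V(n, w) of vertices
-- satisfies V(n, 0) = 1 and V(n + 2, w + 1) = V(n, w) + V(n + 1, w + 1), the recurrence of
-- Fibonacci strings, which Pascal's rule solves by V(n, w) = C(n + 1 - w, w).
module Submission where

open import Defs
open import Data.Nat using (ℕ; _≤_; _∸_; _+_; ⌈_/2⌉)
open import Data.Nat.Combinatorics using (_C_)
open import Data.List using (length; filter)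
open import Data.Nat.Properties using (_≟_)
open import Relation.Binary.PropositionalEquality using (_≡_)

open import Data.Bool using (Bool; true; false; _∧_; if_then_else_; T)
open import Data.Bool.Properties using (T?)
open import Data.List using (List; []; _∷_; _++_; map; replicate; foldl)
open import Data.List.Properties using (++-assoc; ++-identityʳ; filter-++; filter-≐; length-++; length-map)
open import Data.Nat using (zero; suc; _<ᵇ_; z≤n; s≤s)
open import Data.Nat.Combinatorics using (nCk+nC[k+1]≡[n+1]C[k+1]; k>n⇒nCk≡0)
open import Data.Nat.Properties
  using (_≤?_; ≰⇒>; <⇒≤; +-∸-assoc; +-∸-comm; +-comm; m≤n⇒m∸n≡0; 0∸n≡0; ≤-trans; ⌈n/2⌉≤n)
open import Data.Product using (_,_)
open import Data.Vec using (Vec; toList)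
import Data.Vec as Vec
open import Function using (_∘_)
open import Relation.Nullary using (does; yes; no)
open import Relation.Unary using (Pred; Decidable; _≐_)
open import Level using (0ℓ)
open import Relation.Unary.Properties using (∅?)
open import Relation.Binary.PropositionalEquality using (refl; sym; trans; cong; cong₂; subst; module ≡-Reasoning)

private
  variable
    A B : Set

filter-map : ∀ {p q} {P : Pred B p} {Q : Pred A q} (P? : Decidable P) (Q? : Decidable Q) (f : A → B) →
             (∀ x → does (P? (f x)) ≡ does (Q? x)) → ∀ xs → filter P? (map f xs) ≡ map f (filter Q? xs)
filter-map P? Q? f agree [] = refl
filter-map P? Q? f agree (x ∷ xs) with does (P? (f x)) | does (Q? x) | agree x
... | true  | .true  | refl = cong (f x ∷_) (filter-map P? Q? f agree xs)
... | false | .false | refl = filter-map P? Q? f agree xs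

filter-∅ : (xs : List A) → filter ∅? xs ≡ []
filter-∅ []       = refl
filter-∅ (x ∷ xs) = filter-∅ xs

replicate-++-∷ : ∀ n (x : A) xs → replicate n x ++ x ∷ xs ≡ x ∷ replicate n x ++ xs
replicate-++-∷ zero    x xs = refl
replicate-++-∷ (suc n) x xs = cong (x ∷_) (replicate-++-∷ n x xs)

module Automaton {S : Set} (δ : S → A → S) (accepting : S → Bool) where

  accepts : S → List A → Bool
  accepts σ = accepting ∘ foldl δ σ

  accepts-via-representatives :
    (L : List A → Bool) (rep : S → List A) →
    (∀ σ a t → L (rep (δ σ a) ++ t) ≡ L (rep σ ++ a ∷ t)) →
    (∀ σ → accepting σ ≡ L (rep σ)) →
    ∀ σ t → accepts σ t ≡ L (rep σ ++ t)
  accepts-via-representatives L rep rep-step rep-accepting σ [] =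
    trans (rep-accepting σ) (cong L (sym (++-identityʳ (rep σ))))
  accepts-via-representatives L rep rep-step rep-accepting σ (a ∷ t) =
    trans (accepts-via-representatives L rep rep-step rep-accepting (δ σ a) t) (rep-step σ a t)

module Counting {S : Set} (δ : S → Bool → S) (accepting : S → Bool) (suffix : List Bool) where

  open Automaton δ accepting

  AcceptsWithSuffix : S → ∀ {n} → Pred (Vec Bool n) 0ℓ
  AcceptsWithSuffix σ v = T (accepts σ (toList v ++ suffix))

  acceptsWithSuffix? : ∀ σ {n} → Decidable (AcceptsWithSuffix σ {n})
  acceptsWithSuffix? σ v = T? (accepts σ (toList v ++ suffix))

  countAccepted : S → ℕ → ∀ {n} → List (Vec Bool n) → ℕ
  countAccepted σ w xs = length (filter (λ v → weight v ≟ w) (filter (acceptsWithSuffix? σ) xs))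

  completions : S → ℕ → ℕ → ℕ
  completions σ zero    zero    = if accepts σ suffix then 1 else 0
  completions σ zero    (suc w) = 0
  completions σ (suc n) zero    = completions (δ σ false) n zero
  completions σ (suc n) (suc w) = completions (δ σ true) n w + completions (δ σ false) n (suc w)

  countAccepted-++ : ∀ σ w {n} (xs ys : List (Vec Bool n)) →
                     countAccepted σ w (xs ++ ys) ≡ countAccepted σ w xs + countAccepted σ w ys
  countAccepted-++ σ w {n} xs ys = begin
    length (filter W? (filter (acceptsWithSuffix? σ) (xs ++ ys)))
      ≡⟨ cong (length ∘ filter W?) (filter-++ (acceptsWithSuffix? σ) xs ys) ⟩
    length (filter W? (filter (acceptsWithSuffix? σ) xs ++ filter (acceptsWithSuffix? σ) ys))
      ≡⟨ cong length (filter-++ W? (filter (acceptsWithSuffix? σ) xs) _) ⟩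
    length (filter W? (filter (acceptsWithSuffix? σ) xs) ++ filter W? (filter (acceptsWithSuffix? σ) ys))
      ≡⟨ length-++ (filter W? (filter (acceptsWithSuffix? σ) xs)) ⟩
    countAccepted σ w xs + countAccepted σ w ys ∎
    where
    open ≡-Reasoning
    W? = λ (v : Vec Bool n) → weight v ≟ w

  countAccepted-∷ : ∀ σ b w w′ {n} → (∀ (v : Vec Bool n) → does (weight (b Vec.∷ v) ≟ w) ≡ does (weight v ≟ w′)) →
                    ∀ xs → countAccepted σ w (map (b Vec.∷_) xs) ≡ countAccepted (δ σ b) w′ xs
  countAccepted-∷ σ b w w′ {n} agree xs = begin
    length (filter W? (filter (acceptsWithSuffix? σ) (map (b Vec.∷_) xs)))
      ≡⟨ cong (length ∘ filter W?) (filter-map (acceptsWithSuffix? σ) (acceptsWithSuffix? (δ σ b)) (b Vec.∷_) (λ _ → refl) xs) ⟩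
    length (filter W? (map (b Vec.∷_) (filter (acceptsWithSuffix? (δ σ b)) xs)))
      ≡⟨ cong length (filter-map W? (λ v → weight v ≟ w′) (b Vec.∷_) agree (filter (acceptsWithSuffix? (δ σ b)) xs)) ⟩
    length (map (b Vec.∷_) (filter (λ v → weight v ≟ w′) (filter (acceptsWithSuffix? (δ σ b)) xs)))
      ≡⟨ length-map (b Vec.∷_) (filter (λ v → weight v ≟ w′) (filter (acceptsWithSuffix? (δ σ b)) xs)) ⟩
    countAccepted (δ σ b) w′ xs ∎
    where
    open ≡-Reasoning
    W? = λ (v : Vec Bool (suc n)) → weight v ≟ w

  countAccepted-true∷-zero : ∀ σ {n} (xs : List (Vec Bool n)) → countAccepted σ 0 (map (true Vec.∷_) xs) ≡ 0
  countAccepted-true∷-zero σ {n} xs = begin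
    length (filter W? (filter (acceptsWithSuffix? σ) (map (true Vec.∷_) xs)))
      ≡⟨ cong (length ∘ filter W?) (filter-map (acceptsWithSuffix? σ) (acceptsWithSuffix? (δ σ true)) (true Vec.∷_) (λ _ → refl) xs) ⟩
    length (filter W? (map (true Vec.∷_) (filter (acceptsWithSuffix? (δ σ true)) xs)))
      ≡⟨ cong length (filter-map W? ∅? (true Vec.∷_) (λ _ → refl) (filter (acceptsWithSuffix? (δ σ true)) xs)) ⟩
    length (map (true Vec.∷_) (filter ∅? (filter (acceptsWithSuffix? (δ σ true)) xs)))
      ≡⟨ cong (length ∘ map (true Vec.∷_)) (filter-∅ (filter (acceptsWithSuffix? (δ σ true)) xs)) ⟩
    0 ∎
    where
    open ≡-Reasoning
    W? = λ (v : Vec Bool (suc n)) → weight v ≟ 0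

  countAccepted-allVecs : ∀ σ n w → countAccepted σ w (allVecs n) ≡ completions σ n w
  countAccepted-allVecs σ zero zero with accepts σ suffix
  ... | true  = refl
  ... | false = refl
  countAccepted-allVecs σ zero (suc w) with accepts σ suffix
  ... | true  = refl
  ... | false = refl
  countAccepted-allVecs σ (suc n) w =
    trans (countAccepted-++ σ w (headed true) (headed false)) (by-head w)
    where
    headed : Bool → List (Vec Bool (suc n))
    headed b = map (b Vec.∷_) (allVecs n)

    headed-false : ∀ w → countAccepted σ w (headed false) ≡ completions (δ σ false) n w
    headed-false w = trans (countAccepted-∷ σ false w w (λ _ → refl) (allVecs n)) (countAccepted-allVecs (δ σ false) n w)

    by-head : ∀ w → countAccepted σ w (headed true) + countAccepted σ w (headed false) ≡ completions σ (suc n) w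
    by-head zero    = cong₂ _+_ (countAccepted-true∷-zero σ (allVecs n)) (headed-false zero)
    by-head (suc w) = cong₂ _+_
      (trans (countAccepted-∷ σ true (suc w) w (λ _ → refl) (allVecs n)) (countAccepted-allVecs (δ σ true) n w))
      (headed-false (suc w))

runConstrainedᵇ : List Bool → Bool
runConstrainedᵇ = rcRuns ∘ runs

leadingZeros : List Bool → ℕ
leadingZeros (false ∷ t) = suc (leadingZeros t)
leadingZeros _           = 0

dropZeros : List Bool → List Bool
dropZeros (false ∷ t) = dropZeros t
dropZeros t           = t

runs-false∷ : ∀ t → runs (false ∷ t) ≡ (false , suc (leadingZeros t)) ∷ runs (dropZeros t)
runs-false∷ []          = refl
runs-false∷ (false ∷ t) rewrite runs-false∷ t = refl
runs-false∷ (true ∷ t) with runs t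
... | []               = refl
... | (false , k) ∷ rs = refl
... | (true , k) ∷ rs  = refl

runs-ones-false∷ : ∀ a t → runs (replicate (suc a) true ++ false ∷ t) ≡ (true , suc a) ∷ runs (false ∷ t)
runs-ones-false∷ zero    t rewrite runs-false∷ t = refl
runs-ones-false∷ (suc a) t rewrite runs-ones-false∷ a t = refl

runs-ones : ∀ a → runs (replicate (suc a) true) ≡ (true , suc a) ∷ []
runs-ones zero    = refl
runs-ones (suc a) rewrite runs-ones a = refl

runConstrainedᵇ-dropZeros : ∀ t → runConstrainedᵇ t ≡ runConstrainedᵇ (dropZeros t)
runConstrainedᵇ-dropZeros []          = refl
runConstrainedᵇ-dropZeros (true ∷ t)  = refl
runConstrainedᵇ-dropZeros (false ∷ t) = cong rcRuns (runs-false∷ t)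

runConstrainedᵇ-false∷ : ∀ t → runConstrainedᵇ (false ∷ t) ≡ runConstrainedᵇ t
runConstrainedᵇ-false∷ t =
  trans (runConstrainedᵇ-dropZeros (false ∷ t)) (sym (runConstrainedᵇ-dropZeros t))

runConstrainedᵇ-ones-false∷ : ∀ a t →
  runConstrainedᵇ (replicate (suc a) true ++ false ∷ t) ≡ (a <ᵇ leadingZeros t) ∧ runConstrainedᵇ t
runConstrainedᵇ-ones-false∷ a t rewrite runs-ones-false∷ a t | runs-false∷ t =
  cong ((a <ᵇ leadingZeros t) ∧_) (sym (runConstrainedᵇ-dropZeros t))

runConstrainedᵇ-ones : ∀ a → runConstrainedᵇ (replicate (suc a) true) ≡ false
runConstrainedᵇ-ones a = cong rcRuns (runs-ones a)

-- ones j: the word read so far ends in j unpaid 1s; owes j: it ends in 1s followed by 0s,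
-- and j + 1 more 0s are needed.
data State : Set where
  ones owes : ℕ → State
  dead      : State

step : State → Bool → State
step (ones j)       true  = ones (suc j)
step (ones zero)    false = ones zero
step (ones (suc j)) false = owes j
step (owes j)       true  = dead
step (owes zero)    false = ones zero
step (owes (suc j)) false = owes j
step dead           _     = dead

accepting : State → Bool
accepting (ones zero) = true
accepting _           = false

representative : State → List Bool
representative (ones j) = replicate j true
representative (owes j) = replicate (suc j) true ++ false ∷ []
representative dead     = true ∷ false ∷ true ∷ []

runConstrainedᵇ-owes : ∀ j t →
  runConstrainedᵇ (representative (owes j) ++ t) ≡ (j <ᵇ leadingZeros t) ∧ runConstrainedᵇ t
runConstrainedᵇ-owes j t =
  trans (cong runConstrainedᵇ (++-assoc (replicate (suc j) true) (false ∷ []) t)) (runConstrainedᵇ-ones-false∷ j t)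

runConstrainedᵇ-dead : ∀ t → runConstrainedᵇ (representative dead ++ t) ≡ false
runConstrainedᵇ-dead t = runConstrainedᵇ-owes 0 (true ∷ t)

step-representative : ∀ σ b t →
  runConstrainedᵇ (representative (step σ b) ++ t) ≡ runConstrainedᵇ (representative σ ++ b ∷ t)
step-representative (ones j)       true  t = cong runConstrainedᵇ (sym (replicate-++-∷ j true t))
step-representative (ones zero)    false t = sym (runConstrainedᵇ-false∷ t)
step-representative (ones (suc j)) false t = cong runConstrainedᵇ (++-assoc (replicate (suc j) true) (false ∷ []) t)
step-representative (owes j)       true  t = trans (runConstrainedᵇ-dead t) (sym (runConstrainedᵇ-owes j (true ∷ t)))
step-representative (owes zero)    false t =
  trans (sym (runConstrainedᵇ-false∷ t)) (sym (runConstrainedᵇ-owes 0 (false ∷ t)))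
step-representative (owes (suc j)) false t =
  trans (runConstrainedᵇ-owes j t)
        (trans (cong ((j <ᵇ leadingZeros t) ∧_) (sym (runConstrainedᵇ-false∷ t)))
               (sym (runConstrainedᵇ-owes (suc j) (false ∷ t))))
step-representative dead           b     t = trans (runConstrainedᵇ-dead t) (sym (runConstrainedᵇ-dead (b ∷ t)))

accepting-representative : ∀ σ → accepting σ ≡ runConstrainedᵇ (representative σ)
accepting-representative (ones zero)    = refl
accepting-representative (ones (suc j)) = sym (runConstrainedᵇ-ones j)
accepting-representative (owes j)       =
  sym (trans (cong runConstrainedᵇ (sym (++-identityʳ (representative (owes j))))) (runConstrainedᵇ-owes j []))
accepting-representative dead           = refl

open Automaton step accepting using (accepts; accepts-via-representatives)

runConstrainedᵇ-accepts : ∀ s → runConstrainedᵇ s ≡ accepts (ones zero) s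
runConstrainedᵇ-accepts s =
  sym (accepts-via-representatives runConstrainedᵇ representative step-representative accepting-representative (ones zero) s)

open Counting step accepting (false ∷ false ∷ [])

completions-dead : ∀ n w → completions dead n w ≡ 0
completions-dead zero    zero    = refl
completions-dead zero    (suc w) = refl
completions-dead (suc n) zero    = completions-dead n zero
completions-dead (suc n) (suc w) = cong₂ _+_ (completions-dead n w) (completions-dead n (suc w))

completions-owes-weight-zero : ∀ j n → completions (owes j) n 0 ≡ completions (ones j) n 0
completions-owes-weight-zero zero    zero    = refl
completions-owes-weight-zero zero    (suc n) = refl
completions-owes-weight-zero (suc j) zero    = refl
completions-owes-weight-zero (suc j) (suc n) = refl

completions-owes-true : ∀ j n w → completions (owes j) (suc n) (suc w) ≡ completions (step (ones j) false) n (suc w)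
completions-owes-true zero    n w = cong (_+ completions (ones zero) n (suc w)) (completions-dead n w)
completions-owes-true (suc j) n w = cong (_+ completions (owes j) n (suc w)) (completions-dead n w)

-- Deleting one 1 and one 0 from the current block preserves the run constraint.
completions-ones-suc : ∀ j n w → completions (ones (suc j)) (suc n) w ≡ completions (ones j) n w
completions-ones-suc j zero    zero          = completions-owes-weight-zero j zero
completions-ones-suc j zero    (suc zero)    = refl
completions-ones-suc j zero    (suc (suc w)) = refl
completions-ones-suc j (suc n) zero          = completions-owes-weight-zero j (suc n)
completions-ones-suc j (suc n) (suc w)       = cong₂ _+_ (completions-ones-suc (suc j) n w) (completions-owes-true j n w)

completions-start-weight-zero : ∀ n → completions (ones zero) n 0 ≡ 1
completions-start-weight-zero zero    = refl
completions-start-weight-zero (suc n) = completions-start-weight-zero n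

completions-start-recurrence : ∀ n w →
  completions (ones zero) (suc (suc n)) (suc w) ≡ completions (ones zero) n w + completions (ones zero) (suc n) (suc w)
completions-start-recurrence n w = cong (_+ completions (ones zero) (suc n) (suc w)) (completions-ones-suc zero n w)

pascal-shifted : ∀ m w → (suc m ∸ w) C w + (suc m ∸ w) C suc w ≡ (suc (suc m) ∸ w) C suc w
pascal-shifted m w with w ≤? suc m
... | yes w≤1+m = trans (nCk+nC[k+1]≡[n+1]C[k+1] (suc m ∸ w) w) (cong (_C suc w) (sym (+-∸-assoc 1 w≤1+m)))
... | no  w≰1+m rewrite m≤n⇒m∸n≡0 (≰⇒> w≰1+m) | m≤n⇒m∸n≡0 (<⇒≤ (≰⇒> w≰1+m)) =
  cong (_+ 0) (k>n⇒nCk≡0 (≤-trans (s≤s z≤n) (≰⇒> w≰1+m)))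

-- Written with suc n ∸ w rather than n ∸ w + 1, the formula also holds (as 0 = 0) for w > n,
-- which the induction passes through.
completions-start-binomial : ∀ n w → completions (ones zero) n w ≡ (suc n ∸ w) C w
completions-start-binomial n                   zero          = completions-start-weight-zero n
completions-start-binomial zero                (suc w)       = sym (cong (_C suc w) (0∸n≡0 w))
completions-start-binomial (suc zero)          (suc zero)    = refl
completions-start-binomial (suc zero)          (suc (suc w)) = sym (cong (_C suc (suc w)) (0∸n≡0 w))
completions-start-binomial (suc (suc n))       (suc w)       = begin
  completions (ones zero) (suc (suc n)) (suc w)                          ≡⟨ completions-start-recurrence n w ⟩
  completions (ones zero) n w + completions (ones zero) (suc n) (suc w)  ≡⟨ cong₂ _+_ (completions-start-binomial n w)
                                                                                        (completions-start-binomial (suc n) (suc w)) ⟩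
  (suc n ∸ w) C w + (suc n ∸ w) C suc w                                  ≡⟨ pascal-shifted n w ⟩
  (suc (suc n) ∸ w) C suc w                                              ∎
  where open ≡-Reasoning

isVertex≐accepts : ∀ {n} → IsVertex {n} ≐ AcceptsWithSuffix (ones zero)
isVertex≐accepts = (λ {v} → subst T (runConstrainedᵇ-accepts (toList v ++ false ∷ false ∷ [])))
                 , (λ {v} → subst T (sym (runConstrainedᵇ-accepts (toList v ++ false ∷ false ∷ []))))

corollary3p2 : (n : ℕ) → 1 ≤ n → (w : ℕ) → w ≤ ⌈ n /2⌉ →
    length (filter (λ v → weight v ≟ w) (vertices n)) ≡ (n ∸ w + 1) C w
corollary3p2 n _ w w≤⌈n/2⌉ = begin
  length (filter (λ v → weight v ≟ w) (filter isVertex? (allVecs n)))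
    ≡⟨ cong (length ∘ filter (λ v → weight v ≟ w))
            (filter-≐ isVertex? (acceptsWithSuffix? (ones zero)) isVertex≐accepts (allVecs n)) ⟩
  countAccepted (ones zero) w (allVecs n)  ≡⟨ countAccepted-allVecs (ones zero) n w ⟩
  completions (ones zero) n w              ≡⟨ completions-start-binomial n w ⟩
  (suc n ∸ w) C w                          ≡⟨ cong (_C w) (trans (cong (_∸ w) (+-comm 1 n)) (+-∸-comm 1 w≤n)) ⟩
  (n ∸ w + 1) C w                          ∎
  where
  open ≡-Reasoning
  w≤n : w ≤ n
  w≤n = ≤-trans w≤⌈n/2⌉ (⌈n/2⌉≤n n)
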